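{- Let $x>0$ be a positive rational number. Then \[ x=\frac{\#\mathcal{M}^\perp(x)}{\#\mathcal{M}^\parallel(x)} \] and the fraction on the right-hand side is reduced.
   Context: Let $[a_0;\dots,a_{2\ell-1}]$ be the even-length continued fraction expansion of $x$ ($\ell\ge1$, $a_0\ge0$, $a_i\ge1$ for $i\ge1$) and $W(x)=\mathtt{1}^{a_0}\mathtt{0}^{a_1}\cdots\mathtt{1}^{a_{2\ell-2}}\mathtt{0}^{a_{2\ell-1}-1}$. Define $\theta$ on words over $\{\mathtt0,\mathtt1\}$ by $\theta(\varepsilon)=\varepsilon$ and $\theta(\alpha w)=\overline{\alpha}\theta(w)$ if $|w|$ is even, $\alpha\theta(w)$ if $|w|$ is odd, where $\overline{\mathtt0}=\mathtt1,\overline{\mathtt1}=\mathtt0$. For a word $p$, $\vec p=(|p|_\mathtt0,|p|_\mathtt1)$; $S_g$ denotes the four edges of the unit square with lower-left corner $g\in\mathbb{Z}^2$. The snake graph $G(w)$ has vertex set $\{\vec p: p\text{ prefix of }w\}+\{(0,0),(1,0),(0,1),(1,1)\}$ and edge set $\bigcup_{p\text{ prefix of }w}S_{\vec p}$. $\mathcal{G}(x)=G(w)$ with $w=\theta(W(x))$. The first edge of a perfect matching is the edge containing $(0,0)$. A perfect matching is a $\perp$-matching if ($|w|$ even and its first edge is horizontal) or ($|w|$ odd and its first edge is vertical), and a $\parallel$-matching otherwise; $\mathcal{M}^\perp(x)$, $\mathcal{M}^\parallel(x)$ denote the sets of such perfect matchings of $\mathcal{G}(x)$. -}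

module Defs where

open import Data.Bool using (Bool; true; false; not; _∧_; _∨_; if_then_else_)
open import Data.Nat using (ℕ; zero; suc; _+_; _*_; _∸_; _≡ᵇ_)
open import Data.List using (List; []; _∷_; _++_; length; replicate; map; concatMap; filterᵇ; inits)
open import Data.Product using (_×_; _,_; proj₁; proj₂)
open import Relation.Binary.PropositionalEquality using (_≡_)

-- Letters: 𝟎 is false, 𝟏 is true.
Word : Set
Word = List Bool

-- W(x) from the even-length continued fraction [a₀; a₁, …, a_{2ℓ-1}]
-- (given as a list of length 2ℓ):
-- 1^{a₀} 0^{a₁} ⋯ 1^{a_{2ℓ-2}} 0^{a_{2ℓ-1} - 1}.
Wcf : List ℕ → Word
Wcf (a ∷ b ∷ []) = replicate a true ++ replicate (b ∸ 1) false
Wcf (a ∷ b ∷ rest@(_ ∷ _)) = replicate a true ++ replicate b false ++ Wcf rest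
Wcf _ = []

cfVal : List ℕ → ℕ × ℕ
cfVal [] = 0 , 1
cfVal (a ∷ []) = a , 1
cfVal (a ∷ rest@(_ ∷ _)) with cfVal rest
... | p , q = a * p + q , p

isEven : ℕ → Bool
isEven zero = true
isEven (suc n) = not (isEven n)

θ : Word → Word
θ [] = []
θ (α ∷ w) = (if isEven (length w) then not α else α) ∷ θ w

Point : Set
Point = ℕ × ℕ

Edge : Set
Edge = Point × Point

count : Bool → Word → ℕ
count b [] = 0
count b (c ∷ w) = (if (b ∧ c) ∨ (not b ∧ not c) then 1 else 0) + count b w

vec : Word → Point
vec p = count false p , count true p

_==ᴾ_ : Point → Point → Bool
(a , b) ==ᴾ (c , d) = (a ≡ᵇ c) ∧ (b ≡ᵇ d)

_==ᴱ_ : Edge → Edge → Bool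
(u , v) ==ᴱ (u' , v') = (u ==ᴾ u') ∧ (v ==ᴾ v')

elemᴱ : Edge → List Edge → Bool
elemᴱ e [] = false
elemᴱ e (f ∷ es) = (e ==ᴱ f) ∨ elemᴱ e es

dedupᴱ : List Edge → List Edge
dedupᴱ [] = []
dedupᴱ (e ∷ es) = if elemᴱ e es then dedupᴱ es else e ∷ dedupᴱ es

corners : Point → List Point
corners (i , j) = (i , j) ∷ (suc i , j) ∷ (i , suc j) ∷ (suc i , suc j) ∷ []

S : Point → List Edge
S (i , j) = ((i , j) , (suc i , j)) ∷ ((i , suc j) , (suc i , suc j))
          ∷ ((i , j) , (i , suc j)) ∷ ((suc i , j) , (suc i , suc j)) ∷ []

vertices : Word → List Point
vertices w = concatMap (λ p → corners (vec p)) (inits w)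

edges : Word → List Edge
edges w = dedupᴱ (concatMap (λ p → S (vec p)) (inits w))

incident : Point → Edge → Bool
incident v (a , b) = (v ==ᴾ a) ∨ (v ==ᴾ b)

countIncident : Point → List Edge → ℕ
countIncident v [] = 0
countIncident v (e ∷ es) = (if incident v e then 1 else 0) + countIncident v es

allB : {A : Set} → (A → Bool) → List A → Bool
allB P [] = true
allB P (x ∷ xs) = P x ∧ allB P xs

isPerfectMatching : Word → List Edge → Bool
isPerfectMatching w M = allB (λ v → countIncident v M ≡ᵇ 1) (vertices w)

subsets : {A : Set} → List A → List (List A)
subsets [] = [] ∷ []
subsets (x ∷ xs) = let s = subsets xs in s ++ map (x ∷_) s

perfectMatchings : Word → List (List Edge)
perfectMatchings w = filterᵇ (λ M → isPerfectMatching w M) (subsets (edges w))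

horizontal : Edge → Bool
horizontal ((_ , y) , (_ , y')) = y ≡ᵇ y'

firstEdgeHorizontal : List Edge → Bool
firstEdgeHorizontal [] = false
firstEdgeHorizontal (e ∷ es) = if incident (0 , 0) e then horizontal e else firstEdgeHorizontal es

isPerp : Word → List Edge → Bool
isPerp w M = (isEven (length w) ∧ firstEdgeHorizontal M)
           ∨ (not (isEven (length w)) ∧ not (firstEdgeHorizontal M))

snakeWord : List ℕ → Word
snakeWord as = θ (Wcf as)

numPerp : List ℕ → ℕ
numPerp as = length (filterᵇ (λ M → isPerp (snakeWord as) M)
                             (perfectMatchings (snakeWord as)))

numPar : List ℕ → ℕ
numPar as = length (filterᵇ (λ M → not (isPerp (snakeWord as) M))
                            (perfectMatchings (snakeWord as)))

data AllPos : List ℕ → Set where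
  []  : AllPos []
  _∷_ : ∀ {a as} → 1 Data.Nat.≤ a → AllPos as → AllPos (a ∷ as)

record EvenCF (as : List ℕ) : Set where
  field
    ℓ       : ℕ
    ℓ≥1     : 1 Data.Nat.≤ ℓ
    len     : length as ≡ 2 * ℓ
    tailPos : AllPos (Data.List.drop 1 as)

{-# OPTIONS --safe #-}
-- Removing the first tile of the snake graph G(α ∷ w) leaves a shifted copy of G(w). A perfect
-- matching restricts to a matching of G(w) in which either no vertex, or the two vertices of the
-- left or of the bottom edge of its first tile, are already covered. The three resulting counts
-- satisfy a linear recursion which, for the numbers H and V of perfect matchings whose first
-- edge is horizontal resp. vertical, reads
--   H (𝟎 ∷ w) = V w,   V (𝟎 ∷ w) = H w + V w,   H (𝟏 ∷ w) = H w + V w,   V (𝟏 ∷ w) = H w.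
-- Through θ and the parity convention for ⊥-matchings, (#⊥ , #∥) of θ W follows the continuant
-- recursion (p , q) ↦ (p + q , q) for 𝟏 and (p , p + q) for 𝟎 along W, which on
-- W(x) = 𝟏^{a₀} 𝟎^{a₁} ⋯ computes numerator and denominator of [a₀; a₁, …]. Both steps are
-- unimodular, so this pair is coprime and hence the reduced fraction of x.
module Submission where

open import Defs
open import Data.Nat using (ℕ; _*_)
open import Data.Nat.Coprimality using (Coprime)
open import Data.Integer using (+_)
open import Data.List using (List)
open import Data.Product using (_×_; proj₁; proj₂)
open import Data.Rational using (ℚ; ↥_; ↧ₙ_; _>_; 0ℚ)
open import Relation.Binary.PropositionalEquality using (_≡_)

open import Algebra.Bundles using (CommutativeMonoid)
open import Data.Bool using (Bool; true; false; not; _∧_; _∨_; if_then_else_; T?)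
open import Data.Bool.Properties
  using (∧-assoc; ∧-zeroʳ; ∨-identityʳ; not-involutive; ∧-commutativeMonoid)
open import Data.List using ([]; _∷_; _++_; length; map; concatMap; filterᵇ; inits; replicate; drop)
open import Data.List.Membership.Propositional using (_∈_)
open import Data.List.Properties
  using (length-++; filter-++; map-∘; map-id; map-++; map-cong; ++-identityʳ;
         concatMap-++; concatMap-cong; concatMap-map; map-concatMap)
open import Data.List.Relation.Binary.Pointwise using (Pointwise; []; _∷_; Pointwise-≡⇒≡)
open import Data.List.Relation.Binary.Subset.Propositional using (_⊆_)
open import Data.List.Relation.Unary.All using (All; []; _∷_)
import Data.List.Relation.Unary.All as All
open import Data.List.Relation.Unary.Any using (here; there)
open import Data.Nat using (zero; suc; _+_; _≡ᵇ_; _<_; s≤s; z≤n)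
open import Data.Nat.Coprimality using (coprime-+)
import Data.Nat.Coprimality as Coprime
open import Data.Nat.Divisibility using (∣1⇒≡1)
open import Data.Nat.ListAction using (sum)
open import Data.Nat.Properties
  using (+-assoc; +-comm; +-identityʳ; +-suc; *-suc; suc-injective; <-≤-trans; m≤n+m)
open import Data.Product using (_,_)
open import Data.Rational using (mkℚ)
open import Data.Rational.Base using (*≡*)
open import Data.Rational.Properties using (≃⇒≡)
open import Function using (_∘_; id; const)
open import Relation.Binary.PropositionalEquality
  using (refl; sym; trans; cong; cong₂; subst; subst₂; _≗_; module ≡-Reasoning)

open import Algebra.Properties.CommutativeSemigroup (CommutativeMonoid.commutativeSemigroup ∧-commutativeMonoid)
  using (x∙yz≈y∙xz)
open import Algebra.Solver.CommutativeMonoid ∧-commutativeMonoid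
  using (solve; _⊕_; _⊜_) renaming (id to ε)

module _ {A : Set} where

  countᵇ : (A → Bool) → List A → ℕ
  countᵇ P xs = length (filterᵇ P xs)

  countᵇ-++ : ∀ P xs ys → countᵇ P (xs ++ ys) ≡ countᵇ P xs + countᵇ P ys
  countᵇ-++ P xs ys = trans (cong length (filter-++ (T? ∘ P) xs ys)) (length-++ (filterᵇ P xs))

  countᵇ-cong : ∀ {P Q} → P ≗ Q → countᵇ P ≗ countᵇ Q
  countᵇ-cong P≗Q [] = refl
  countᵇ-cong {P} {Q} P≗Q (x ∷ xs) with P x | Q x | P≗Q x
  ... | true  | .true  | refl = cong suc (countᵇ-cong P≗Q xs)
  ... | false | .false | refl = countᵇ-cong P≗Q xs

  countᵇ-false : ∀ xs → countᵇ (λ _ → false) xs ≡ 0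
  countᵇ-false [] = refl
  countᵇ-false (x ∷ xs) = countᵇ-false xs

  countᵇ-filterᵇ : ∀ (P Q : A → Bool) xs → countᵇ Q (filterᵇ P xs) ≡ countᵇ (λ x → Q x ∧ P x) xs
  countᵇ-filterᵇ P Q [] = refl
  countᵇ-filterᵇ P Q (x ∷ xs) with P x
  ... | false with Q x
  ...   | true  = countᵇ-filterᵇ P Q xs
  ...   | false = countᵇ-filterᵇ P Q xs
  countᵇ-filterᵇ P Q (x ∷ xs) | true with Q x
  ...   | true  = cong suc (countᵇ-filterᵇ P Q xs)
  ...   | false = countᵇ-filterᵇ P Q xs

  countᵇ-split : ∀ (P Q : A → Bool) xs →
    countᵇ P xs ≡ countᵇ (λ x → Q x ∧ P x) xs + countᵇ (λ x → not (Q x) ∧ P x) xs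
  countᵇ-split P Q [] = refl
  countᵇ-split P Q (x ∷ xs) with P x
  ... | false with Q x
  ...   | true  = countᵇ-split P Q xs
  ...   | false = countᵇ-split P Q xs
  countᵇ-split P Q (x ∷ xs) | true with Q x
  ...   | true  = cong suc (countᵇ-split P Q xs)
  ...   | false = trans (cong suc (countᵇ-split P Q xs)) (sym (+-suc _ _))

  countᵇ-concatMap : ∀ {B : Set} P (f : B → List A) xs →
    countᵇ P (concatMap f xs) ≡ sum (map (countᵇ P ∘ f) xs)
  countᵇ-concatMap P f [] = refl
  countᵇ-concatMap P f (x ∷ xs) =
    trans (countᵇ-++ P (f x) (concatMap f xs)) (cong (_+_ (countᵇ P (f x))) (countᵇ-concatMap P f xs))

module _ {A B : Set} where
  countᵇ-map : ∀ P (f : A → B) xs → countᵇ P (map f xs) ≡ countᵇ (P ∘ f) xs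
  countᵇ-map P f [] = refl
  countᵇ-map P f (x ∷ xs) with P (f x)
  ... | true  = cong suc (countᵇ-map P f xs)
  ... | false = countᵇ-map P f xs

  allB-map : ∀ (g : B → Bool) (f : A → B) xs → allB g (map f xs) ≡ allB (g ∘ f) xs
  allB-map g f [] = refl
  allB-map g f (x ∷ xs) = cong (g (f x) ∧_) (allB-map g f xs)

  subsets-map : ∀ (f : A → B) xs → subsets (map f xs) ≡ map (map f) (subsets xs)
  subsets-map f [] = refl
  subsets-map f (x ∷ xs) = begin
    subsets (map f xs) ++ map (f x ∷_) (subsets (map f xs))
      ≡⟨ cong (λ s → s ++ map (f x ∷_) s) (subsets-map f xs) ⟩
    map (map f) s ++ map (f x ∷_) (map (map f) s)
      ≡⟨ cong (map (map f) s ++_) (trans (sym (map-∘ s)) (map-∘ s)) ⟩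
    map (map f) s ++ map (map f) (map (x ∷_) s)
      ≡⟨ map-++ (map f) s (map (x ∷_) s) ⟨
    map (map f) (s ++ map (x ∷_) s) ∎
    where
    open ≡-Reasoning
    s : List (List A)
    s = subsets xs

module _ {A : Set} where
  subsets-++ : ∀ (xs ys : List A) →
    subsets (xs ++ ys) ≡ concatMap (λ s → map (s ++_) (subsets ys)) (subsets xs)
  subsets-++ [] ys = sym (trans (++-identityʳ _) (map-id (subsets ys)))
  subsets-++ (x ∷ xs) ys = begin
    subsets (xs ++ ys) ++ map (x ∷_) (subsets (xs ++ ys))
      ≡⟨ cong (λ s → s ++ map (x ∷_) s) (subsets-++ xs ys) ⟩
    concatMap g s ++ map (x ∷_) (concatMap g s)
      ≡⟨ cong (concatMap g s ++_) (map-concatMap (x ∷_) g s) ⟩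
    concatMap g s ++ concatMap (map (x ∷_) ∘ g) s
      ≡⟨ cong (concatMap g s ++_) (concatMap-cong (λ t → sym (map-∘ (subsets ys))) s) ⟩
    concatMap g s ++ concatMap (g ∘ (x ∷_)) s
      ≡⟨ cong (concatMap g s ++_) (concatMap-map g (x ∷_) s) ⟨
    concatMap g s ++ concatMap g (map (x ∷_) s)
      ≡⟨ concatMap-++ g s (map (x ∷_) s) ⟨
    concatMap g (s ++ map (x ∷_) s) ∎
    where
    open ≡-Reasoning
    s : List (List A)
    s = subsets xs
    g : List A → List (List A)
    g t = map (t ++_) (subsets ys)

  countᵇ-subsets-++ : ∀ P (xs ys : List A) →
    countᵇ P (subsets (xs ++ ys)) ≡ sum (map (λ s → countᵇ (λ M → P (s ++ M)) (subsets ys)) (subsets xs))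
  countᵇ-subsets-++ P xs ys = begin
    countᵇ P (subsets (xs ++ ys))
      ≡⟨ cong (countᵇ P) (subsets-++ xs ys) ⟩
    countᵇ P (concatMap (λ s → map (s ++_) (subsets ys)) (subsets xs))
      ≡⟨ countᵇ-concatMap P _ (subsets xs) ⟩
    sum (map (λ s → countᵇ P (map (s ++_) (subsets ys))) (subsets xs))
      ≡⟨ cong sum (map-cong (λ s → countᵇ-map P (s ++_) (subsets ys)) (subsets xs)) ⟩
    sum (map (λ s → countᵇ (λ M → P (s ++ M)) (subsets ys)) (subsets xs)) ∎
    where open ≡-Reasoning

  allB-++ : ∀ (g : A → Bool) xs ys → allB g (xs ++ ys) ≡ allB g xs ∧ allB g ys
  allB-++ g [] ys = refl
  allB-++ g (x ∷ xs) ys = trans (cong (g x ∧_) (allB-++ g xs ys)) (sym (∧-assoc (g x) _ _))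

  allB-∈ : ∀ (g : A → Bool) {x xs} → x ∈ xs → g x ∧ allB g xs ≡ allB g xs
  allB-∈ g {x} (here refl) with g x
  ... | true  = refl
  ... | false = refl
  allB-∈ g {x} {y ∷ xs} (there x∈xs) with g x | g y | allB-∈ g x∈xs
  ... | true  | _     | _  = refl
  ... | false | true  | eq = eq
  ... | false | false | _  = refl

  allB-⊆ : ∀ (g : A → Bool) {xs ys} → xs ⊆ ys → allB g xs ∧ allB g ys ≡ allB g ys
  allB-⊆ g {[]} xs⊆ys = refl
  allB-⊆ g {x ∷ xs} {ys} xs⊆ys = begin
    (g x ∧ allB g xs) ∧ allB g ys  ≡⟨ ∧-assoc (g x) _ _ ⟩
    g x ∧ (allB g xs ∧ allB g ys)  ≡⟨ cong (g x ∧_) (allB-⊆ g (xs⊆ys ∘ there)) ⟩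
    g x ∧ allB g ys                ≡⟨ allB-∈ g (xs⊆ys (here refl)) ⟩
    allB g ys                      ∎
    where open ≡-Reasoning

  allB-cong : ∀ {g h : A → Bool} {xs} → All (λ x → g x ≡ h x) xs → allB g xs ≡ allB h xs
  allB-cong [] = refl
  allB-cong (gx≡hx ∷ eqs) = cong₂ _∧_ gx≡hx (allB-cong eqs)

shift : Bool → Point → Point
shift false (i , j) = suc i , j
shift true  (i , j) = i , suc j

shiftᴱ : Bool → Edge → Edge
shiftᴱ α (u , v) = shift α u , shift α v

vec-∷ : ∀ α p → vec (α ∷ p) ≡ shift α (vec p)
vec-∷ false p = refl
vec-∷ true  p = refl

corners-shift : ∀ α g → corners (shift α g) ≡ map (shift α) (corners g)
corners-shift false g = refl
corners-shift true  g = refl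

S-shift : ∀ α g → S (shift α g) ≡ map (shiftᴱ α) (S g)
S-shift false g = refl
S-shift true  g = refl

tiles-∷ : ∀ {A : Set} (tile : Point → List A) (f : A → A) α →
  (∀ g → tile (shift α g) ≡ map f (tile g)) → ∀ w →
  concatMap (tile ∘ vec) (inits (α ∷ w)) ≡ tile (0 , 0) ++ map f (concatMap (tile ∘ vec) (inits w))
tiles-∷ tile f α tile-shift w = cong (tile (0 , 0) ++_) (begin
  concatMap (tile ∘ vec) (map (α ∷_) (inits w))  ≡⟨ concatMap-map (tile ∘ vec) (α ∷_) (inits w) ⟩
  concatMap (tile ∘ vec ∘ (α ∷_)) (inits w)      ≡⟨ concatMap-cong shifted (inits w) ⟩
  concatMap (map f ∘ tile ∘ vec) (inits w)        ≡⟨ map-concatMap f (tile ∘ vec) (inits w) ⟨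
  map f (concatMap (tile ∘ vec) (inits w))        ∎)
  where
  open ≡-Reasoning
  shifted : ∀ p → tile (vec (α ∷ p)) ≡ map f (tile (vec p))
  shifted p = trans (cong tile (vec-∷ α p)) (tile-shift (vec p))

vertices-∷ : ∀ α w → vertices (α ∷ w) ≡ corners (0 , 0) ++ map (shift α) (vertices w)
vertices-∷ α w = tiles-∷ corners (shift α) α (corners-shift α) w

==ᴱ-shift : ∀ α e f → (shiftᴱ α e ==ᴱ shiftᴱ α f) ≡ (e ==ᴱ f)
==ᴱ-shift false e f = refl
==ᴱ-shift true  e f = refl

elemᴱ-shift : ∀ α e es → elemᴱ (shiftᴱ α e) (map (shiftᴱ α) es) ≡ elemᴱ e es
elemᴱ-shift α e [] = refl
elemᴱ-shift α e (f ∷ es) = cong₂ _∨_ (==ᴱ-shift α e f) (elemᴱ-shift α e es)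

dedupᴱ-shift : ∀ α es → dedupᴱ (map (shiftᴱ α) es) ≡ map (shiftᴱ α) (dedupᴱ es)
dedupᴱ-shift α [] = refl
dedupᴱ-shift α (e ∷ es) rewrite elemᴱ-shift α e es with elemᴱ e es
... | true  = dedupᴱ-shift α es
... | false = cong (shiftᴱ α e ∷_) (dedupᴱ-shift α es)

elemᴱ-shiftˣ-fresh : ∀ j v es → elemᴱ ((0 , j) , v) (map (shiftᴱ false) es) ≡ false
elemᴱ-shiftˣ-fresh j v [] = refl
elemᴱ-shiftˣ-fresh j v (e ∷ es) = elemᴱ-shiftˣ-fresh j v es

elemᴱ-shiftʸ-fresh : ∀ i v es → elemᴱ ((i , 0) , v) (map (shiftᴱ true) es) ≡ false
elemᴱ-shiftʸ-fresh i v [] = refl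
elemᴱ-shiftʸ-fresh i v (((a , _) , _) ∷ es)
  rewrite ∧-zeroʳ (i ≡ᵇ a) = elemᴱ-shiftʸ-fresh i v es

eᵇ eᵗ eˡ eʳ : Edge
eᵇ = (0 , 0) , (1 , 0)
eᵗ = (0 , 1) , (1 , 1)
eˡ = (0 , 0) , (0 , 1)
eʳ = (1 , 0) , (1 , 1)

firstTile : Bool → List Edge
firstTile false = eᵇ ∷ eᵗ ∷ eˡ ∷ []
firstTile true  = eᵇ ∷ eˡ ∷ eʳ ∷ []

edges-∷ : ∀ α w → edges (α ∷ w) ≡ firstTile α ++ map (shiftᴱ α) (edges w)
edges-∷ α w = trans (cong dedupᴱ (tiles-∷ S (shiftᴱ α) α (S-shift α) w)) (dedup-first α)
  where
  tileEdges : Word → List Edge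
  tileEdges w = concatMap (λ p → S (vec p)) (inits w)
  dedup-first : ∀ α → dedupᴱ (S (0 , 0) ++ map (shiftᴱ α) (tileEdges w))
                      ≡ firstTile α ++ map (shiftᴱ α) (edges w)
  dedup-first false
    rewrite elemᴱ-shiftˣ-fresh 0 (1 , 0) (tileEdges w) | elemᴱ-shiftˣ-fresh 1 (1 , 1) (tileEdges w)
          | elemᴱ-shiftˣ-fresh 0 (0 , 1) (tileEdges w)
    = cong (firstTile false ++_) (dedupᴱ-shift false (tileEdges w))
  dedup-first true
    rewrite elemᴱ-shiftʸ-fresh 0 (1 , 0) (tileEdges w) | elemᴱ-shiftʸ-fresh 0 (0 , 1) (tileEdges w)
          | elemᴱ-shiftʸ-fresh 1 (1 , 1) (tileEdges w)
    = cong (firstTile true ++_) (dedupᴱ-shift true (tileEdges w))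

-- The corners of the first tile that are not corners of the second one.
freshCorners : Bool → List Point
freshCorners false = (0 , 0) ∷ (0 , 1) ∷ []
freshCorners true  = (0 , 0) ∷ (1 , 0) ∷ []

freshCorners⊆vertices : ∀ α w → freshCorners α ⊆ vertices w
freshCorners⊆vertices false w (here refl)         = here refl
freshCorners⊆vertices false w (there (here refl)) = there (there (here refl))
freshCorners⊆vertices true  w (here refl)         = here refl
freshCorners⊆vertices true  w (there (here refl)) = there (here refl)

allB-corners : ∀ (g : Point → Bool) α →
  allB g (corners (0 , 0)) ≡ allB g (freshCorners α) ∧ allB (g ∘ shift α) (freshCorners α)
allB-corners g false = solve 4
  (λ g₀₀ g₁₀ g₀₁ g₁₁ → g₀₀ ⊕ (g₁₀ ⊕ (g₀₁ ⊕ (g₁₁ ⊕ ε))) ⊜ (g₀₀ ⊕ (g₀₁ ⊕ ε)) ⊕ (g₁₀ ⊕ (g₁₁ ⊕ ε)))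
  refl (g (0 , 0)) (g (1 , 0)) (g (0 , 1)) (g (1 , 1))
allB-corners g true = solve 4
  (λ g₀₀ g₁₀ g₀₁ g₁₁ → g₀₀ ⊕ (g₁₀ ⊕ (g₀₁ ⊕ (g₁₁ ⊕ ε))) ⊜ (g₀₀ ⊕ (g₁₀ ⊕ ε)) ⊕ (g₀₁ ⊕ (g₁₁ ⊕ ε)))
  refl (g (0 , 0)) (g (1 , 0)) (g (0 , 1)) (g (1 , 1))

allB-vertices-∷ : ∀ (g : Point → Bool) α w →
  allB g (vertices (α ∷ w)) ≡ allB g (freshCorners α) ∧ allB (g ∘ shift α) (vertices w)
allB-vertices-∷ g α w = begin
  allB g (vertices (α ∷ w))
    ≡⟨ cong (allB g) (vertices-∷ α w) ⟩
  allB g (corners (0 , 0) ++ map (shift α) (vertices w))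
    ≡⟨ allB-++ g (corners (0 , 0)) (map (shift α) (vertices w)) ⟩
  allB g (corners (0 , 0)) ∧ allB g (map (shift α) (vertices w))
    ≡⟨ cong₂ _∧_ (allB-corners g α) (allB-map g (shift α) (vertices w)) ⟩
  (allB g F ∧ allB (g ∘ shift α) F) ∧ allB (g ∘ shift α) (vertices w)
    ≡⟨ ∧-assoc (allB g F) _ _ ⟩
  allB g F ∧ (allB (g ∘ shift α) F ∧ allB (g ∘ shift α) (vertices w))
    ≡⟨ cong (allB g F ∧_) (allB-⊆ (g ∘ shift α) (freshCorners⊆vertices α w)) ⟩
  allB g F ∧ allB (g ∘ shift α) (vertices w) ∎
  where
  open ≡-Reasoning
  F : List Point
  F = freshCorners α

completesOn : List Point → (Point → ℕ) → List Edge → Bool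
completesOn V c M = allB (λ v → c v + countIncident v M ≡ᵇ 1) V

countIncident-++ : ∀ v xs ys → countIncident v (xs ++ ys) ≡ countIncident v xs + countIncident v ys
countIncident-++ v [] ys = refl
countIncident-++ v (e ∷ xs) ys =
  trans (cong (_+_ _) (countIncident-++ v xs ys)) (sym (+-assoc (if incident v e then 1 else 0) _ _))

incident-shift : ∀ α u e → incident (shift α u) (shiftᴱ α e) ≡ incident u e
incident-shift false u e = refl
incident-shift true  u e = refl

countIncident-shift : ∀ α u M → countIncident (shift α u) (map (shiftᴱ α) M) ≡ countIncident u M
countIncident-shift α u [] = refl
countIncident-shift α u (e ∷ M) =
  cong₂ (λ b n → (if b then 1 else 0) + n) (incident-shift α u e) (countIncident-shift α u M)

countIncident-shiftˣ-fresh : ∀ j M → countIncident (0 , j) (map (shiftᴱ false) M) ≡ 0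
countIncident-shiftˣ-fresh j [] = refl
countIncident-shiftˣ-fresh j (e ∷ M) = countIncident-shiftˣ-fresh j M

countIncident-shiftʸ-fresh : ∀ i M → countIncident (i , 0) (map (shiftᴱ true) M) ≡ 0
countIncident-shiftʸ-fresh i [] = refl
countIncident-shiftʸ-fresh i (((a , _) , (c , _)) ∷ M)
  rewrite ∧-zeroʳ (i ≡ᵇ a) | ∧-zeroʳ (i ≡ᵇ c) = countIncident-shiftʸ-fresh i M

countIncident-freshCorners : ∀ α M →
  All (λ v → countIncident v (map (shiftᴱ α) M) ≡ 0) (freshCorners α)
countIncident-freshCorners false M = countIncident-shiftˣ-fresh 0 M ∷ countIncident-shiftˣ-fresh 1 M ∷ []
countIncident-freshCorners true  M = countIncident-shiftʸ-fresh 0 M ∷ countIncident-shiftʸ-fresh 1 M ∷ []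

-- The partial cover that c and the first-tile edges T leave on G(w), in the coordinates of G(w).
passOn : Bool → (Point → ℕ) → List Edge → Point → ℕ
passOn α c T u = c (shift α u) + countIncident (shift α u) T

completes-∷ : ∀ α w c T M →
  completesOn (vertices (α ∷ w)) c (T ++ map (shiftᴱ α) M)
  ≡ completesOn (freshCorners α) c T ∧ completesOn (vertices w) (passOn α c T) M
completes-∷ α w c T M = trans (allB-vertices-∷ _ α w)
  (cong₂ _∧_ (allB-cong (All.map fresh (countIncident-freshCorners α M)))
             (allB-cong (All.universal shifted (vertices w))))
  where
  fresh : ∀ {v} → countIncident v (map (shiftᴱ α) M) ≡ 0 →
          (c v + countIncident v (T ++ map (shiftᴱ α) M) ≡ᵇ 1) ≡ (c v + countIncident v T ≡ᵇ 1)
  fresh {v} unused = cong (λ n → c v + n ≡ᵇ 1)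
    (trans (countIncident-++ v T _) (trans (cong (_+_ (countIncident v T)) unused) (+-identityʳ _)))
  shifted : ∀ u → (c (shift α u) + countIncident (shift α u) (T ++ map (shiftᴱ α) M) ≡ᵇ 1)
                  ≡ (passOn α c T u + countIncident u M ≡ᵇ 1)
  shifted u = cong (_≡ᵇ 1) (trans
    (cong (_+_ (c (shift α u)))
          (trans (countIncident-++ (shift α u) T _)
                 (cong (_+_ (countIncident (shift α u) T)) (countIncident-shift α u M))))
    (sym (+-assoc (c (shift α u)) _ _)))

#completions : Word → (Point → ℕ) → (Bool → Bool) → ℕ
#completions w c f =
  countᵇ (λ M → f (firstEdgeHorizontal M) ∧ completesOn (vertices w) c M) (subsets (edges w))

-- Completions on G(α ∷ w) whose first-tile edges are exactly T. The conjuncts are ordered so that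
-- for concrete α, c, f and T every term that cannot contribute reduces to countᵇ (λ _ → false).
#extensions : Bool → Word → (Point → ℕ) → (Bool → Bool) → List Edge → ℕ
#extensions α w c f T =
  countᵇ (λ M → completesOn (freshCorners α) c T
                ∧ (f (firstEdgeHorizontal (T ++ map (shiftᴱ α) M))
                   ∧ completesOn (vertices w) (passOn α c T) M))
         (subsets (edges w))

#completions-∷ : ∀ α w c f →
  #completions (α ∷ w) c f ≡ sum (map (#extensions α w c f) (subsets (firstTile α)))
#completions-∷ α w c f = begin
  countᵇ P (subsets (edges (α ∷ w)))
    ≡⟨ cong (countᵇ P ∘ subsets) (edges-∷ α w) ⟩
  countᵇ P (subsets (firstTile α ++ map (shiftᴱ α) (edges w)))
    ≡⟨ countᵇ-subsets-++ P (firstTile α) _ ⟩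
  sum (map (λ T → countᵇ (P ∘ (T ++_)) (subsets (map (shiftᴱ α) (edges w))))
           (subsets (firstTile α)))
    ≡⟨ cong sum (map-cong extensions (subsets (firstTile α))) ⟩
  sum (map (#extensions α w c f) (subsets (firstTile α))) ∎
  where
  open ≡-Reasoning
  P : List Edge → Bool
  P M = f (firstEdgeHorizontal M) ∧ completesOn (vertices (α ∷ w)) c M
  split : ∀ T M → P (T ++ map (shiftᴱ α) M)
                  ≡ completesOn (freshCorners α) c T
                    ∧ (f (firstEdgeHorizontal (T ++ map (shiftᴱ α) M))
                       ∧ completesOn (vertices w) (passOn α c T) M)
  split T M = trans (cong (first ∧_) (completes-∷ α w c T M))
                    (x∙yz≈y∙xz first (completesOn (freshCorners α) c T) _)
    where
    first : Bool
    first = f (firstEdgeHorizontal (T ++ map (shiftᴱ α) M))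
  extensions : ∀ T → countᵇ (P ∘ (T ++_)) (subsets (map (shiftᴱ α) (edges w))) ≡ #extensions α w c f T
  extensions T = begin
    countᵇ (P ∘ (T ++_)) (subsets (map (shiftᴱ α) (edges w)))
      ≡⟨ cong (countᵇ (P ∘ (T ++_))) (subsets-map (shiftᴱ α) (edges w)) ⟩
    countᵇ (P ∘ (T ++_)) (map (map (shiftᴱ α)) (subsets (edges w)))
      ≡⟨ countᵇ-map (P ∘ (T ++_)) (map (shiftᴱ α)) (subsets (edges w)) ⟩
    countᵇ (λ M → P (T ++ map (shiftᴱ α) M)) (subsets (edges w))
      ≡⟨ countᵇ-cong (split T) (subsets (edges w)) ⟩
    #extensions α w c f T ∎

#completions-cong : ∀ w {c c'} f → c ≗ c' → #completions w c f ≡ #completions w c' f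
#completions-cong w f c≗c' = countᵇ-cong
  (λ M → cong (f (firstEdgeHorizontal M) ∧_)
              (allB-cong (All.universal (λ v → cong (λ n → n + countIncident v M ≡ᵇ 1) (c≗c' v))
                                        (vertices w))))
  (subsets (edges w))

#completions-split : ∀ w c → #completions w c (const true) ≡ #completions w c id + #completions w c not
#completions-split w c =
  countᵇ-split (completesOn (vertices w) c) firstEdgeHorizontal (subsets (edges w))

-- Which vertices of the second tile the first tile may have covered already: none, those of its
-- left edge (after 𝟎) or those of its bottom edge (after 𝟏).
data Precover : Set where
  none left bottom : Precover

precovered : Precover → Point → ℕ
precovered none   _       = 0
precovered left   (0 , 0) = 1
precovered left   (0 , 1) = 1
precovered left   _       = 0
precovered bottom (0 , 0) = 1
precovered bottom (1 , 0) = 1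
precovered bottom _       = 0

#H #V #L #B : Word → ℕ
#H w = #completions w (precovered none) id
#V w = #completions w (precovered none) not
#L w = #completions w (precovered left) (const true)
#B w = #completions w (precovered bottom) (const true)

pass₀-none-eˡ : passOn false (precovered none) (eˡ ∷ []) ≗ precovered none
pass₀-none-eˡ _ = refl

pass₀-none-eᵇeᵗ : passOn false (precovered none) (eᵇ ∷ eᵗ ∷ []) ≗ precovered left
pass₀-none-eᵇeᵗ (zero , zero)        = refl
pass₀-none-eᵇeᵗ (zero , suc zero)    = refl
pass₀-none-eᵇeᵗ (zero , suc (suc _)) = refl
pass₀-none-eᵇeᵗ (suc _ , _)          = refl

pass₀-left : passOn false (precovered left) [] ≗ precovered none
pass₀-left _ = refl

pass₀-bottom-eᵗ : passOn false (precovered bottom) (eᵗ ∷ []) ≗ precovered left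
pass₀-bottom-eᵗ (zero , zero)        = refl
pass₀-bottom-eᵗ (zero , suc zero)    = refl
pass₀-bottom-eᵗ (zero , suc (suc _)) = refl
pass₀-bottom-eᵗ (suc _ , _)          = refl

pass₁-none-eᵇ : passOn true (precovered none) (eᵇ ∷ []) ≗ precovered none
pass₁-none-eᵇ (zero , _)        = refl
pass₁-none-eᵇ (suc zero , _)    = refl
pass₁-none-eᵇ (suc (suc _) , _) = refl

pass₁-none-eˡeʳ : passOn true (precovered none) (eˡ ∷ eʳ ∷ []) ≗ precovered bottom
pass₁-none-eˡeʳ (zero , zero)        = refl
pass₁-none-eˡeʳ (zero , suc _)       = refl
pass₁-none-eˡeʳ (suc zero , zero)    = refl
pass₁-none-eˡeʳ (suc zero , suc _)   = refl
pass₁-none-eˡeʳ (suc (suc _) , _)    = refl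

pass₁-left-eʳ : passOn true (precovered left) (eʳ ∷ []) ≗ precovered bottom
pass₁-left-eʳ (zero , zero)      = refl
pass₁-left-eʳ (zero , suc _)     = refl
pass₁-left-eʳ (suc zero , zero)  = refl
pass₁-left-eʳ (suc zero , suc _) = refl
pass₁-left-eʳ (suc (suc _) , _)  = refl

pass₁-bottom : passOn true (precovered bottom) [] ≗ precovered none
pass₁-bottom (zero , _)        = refl
pass₁-bottom (suc zero , _)    = refl
pass₁-bottom (suc (suc _) , _) = refl

module _ (w : Word) where
  private
    by-first-tile : ∀ α c f {ys n} →
                    Pointwise _≡_ (map (#extensions α w c f) (subsets (firstTile α))) ys →
                    sum ys ≡ n → #completions (α ∷ w) c f ≡ n
    by-first-tile α c f terms total =
      trans (#completions-∷ α w c f) (trans (cong sum (Pointwise-≡⇒≡ terms)) total)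

    ∅ : countᵇ (λ _ → false) (subsets (edges w)) ≡ 0
    ∅ = countᵇ-false (subsets (edges w))

    via : ∀ {c} p → c ≗ precovered p →
          #completions w c (const true) ≡ #completions w (precovered p) (const true)
    via p = #completions-cong w (const true)

    unconstrained : #completions w (precovered none) (const true) + 0 ≡ #H w + #V w
    unconstrained = trans (+-identityʳ _) (#completions-split w (precovered none))

  -- The eight terms follow subsets (x ∷ y ∷ z ∷ []) = [], [z], [y], [y,z], [x], [x,z], [x,y], [x,y,z].
  transfer-𝟎 : #H (false ∷ w) ≡ #L w × #V (false ∷ w) ≡ #H w + #V w
             × #L (false ∷ w) ≡ #H w + #V w × #B (false ∷ w) ≡ #L w
  transfer-𝟎 =
    by-first-tile false (precovered none) id
      (∅ ∷ ∅ ∷ ∅ ∷ ∅ ∷ ∅ ∷ ∅ ∷ via left pass₀-none-eᵇeᵗ ∷ ∅ ∷ []) (+-identityʳ _) ,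
    by-first-tile false (precovered none) not
      (∅ ∷ via none pass₀-none-eˡ ∷ ∅ ∷ ∅ ∷ ∅ ∷ ∅ ∷ ∅ ∷ ∅ ∷ []) unconstrained ,
    by-first-tile false (precovered left) (const true)
      (via none pass₀-left ∷ ∅ ∷ ∅ ∷ ∅ ∷ ∅ ∷ ∅ ∷ ∅ ∷ ∅ ∷ []) unconstrained ,
    by-first-tile false (precovered bottom) (const true)
      (∅ ∷ ∅ ∷ via left pass₀-bottom-eᵗ ∷ ∅ ∷ ∅ ∷ ∅ ∷ ∅ ∷ ∅ ∷ []) (+-identityʳ _)

  transfer-𝟏 : #H (true ∷ w) ≡ #H w + #V w × #V (true ∷ w) ≡ #B w
             × #L (true ∷ w) ≡ #B w × #B (true ∷ w) ≡ #H w + #V w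
  transfer-𝟏 =
    by-first-tile true (precovered none) id
      (∅ ∷ ∅ ∷ ∅ ∷ ∅ ∷ via none pass₁-none-eᵇ ∷ ∅ ∷ ∅ ∷ ∅ ∷ []) unconstrained ,
    by-first-tile true (precovered none) not
      (∅ ∷ ∅ ∷ ∅ ∷ via bottom pass₁-none-eˡeʳ ∷ ∅ ∷ ∅ ∷ ∅ ∷ ∅ ∷ []) (+-identityʳ _) ,
    by-first-tile true (precovered left) (const true)
      (∅ ∷ via bottom pass₁-left-eʳ ∷ ∅ ∷ ∅ ∷ ∅ ∷ ∅ ∷ ∅ ∷ ∅ ∷ []) (+-identityʳ _) ,
    by-first-tile true (precovered bottom) (const true)
      (via none pass₁-bottom ∷ ∅ ∷ ∅ ∷ ∅ ∷ ∅ ∷ ∅ ∷ ∅ ∷ ∅ ∷ []) unconstrained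

#L≡#V : ∀ w → #L w ≡ #V w
#L≡#V []          = refl
#L≡#V (false ∷ w) = let (_ , v , l , _) = transfer-𝟎 w in trans l (sym v)
#L≡#V (true ∷ w)  = let (_ , v , l , _) = transfer-𝟏 w in trans l (sym v)

#B≡#H : ∀ w → #B w ≡ #H w
#B≡#H []          = refl
#B≡#H (false ∷ w) = let (h , _ , _ , b) = transfer-𝟎 w in trans b (sym h)
#B≡#H (true ∷ w)  = let (h , _ , _ , b) = transfer-𝟏 w in trans b (sym h)

#H-𝟎 : ∀ w → #H (false ∷ w) ≡ #V w
#H-𝟎 w = trans (proj₁ (transfer-𝟎 w)) (#L≡#V w)

#V-𝟎 : ∀ w → #V (false ∷ w) ≡ #H w + #V w
#V-𝟎 w = proj₁ (proj₂ (transfer-𝟎 w))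

#H-𝟏 : ∀ w → #H (true ∷ w) ≡ #H w + #V w
#H-𝟏 w = proj₁ (transfer-𝟏 w)

#V-𝟏 : ∀ w → #V (true ∷ w) ≡ #H w
#V-𝟏 w = trans (proj₁ (proj₂ (transfer-𝟏 w))) (#B≡#H w)

-- b plays the role of isEven (length s) in isPerp.
#⊥ #∥ : Bool → Word → ℕ
#⊥ b s = #completions s (precovered none) (λ h → if b then h else not h)
#∥ b s = #completions s (precovered none) (λ h → if b then not h else h)

#⊥∥-∷ : ∀ α b u → let s = (if b then not α else α) ∷ u in
  #⊥ (not b) s ≡ (if α then #⊥ b u + #∥ b u else #⊥ b u)
  × #∥ (not b) s ≡ (if α then #∥ b u else #⊥ b u + #∥ b u)
#⊥∥-∷ false true  u = #V-𝟏 u , #H-𝟏 u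
#⊥∥-∷ true  true  u = #V-𝟎 u , #H-𝟎 u
#⊥∥-∷ false false u = #H-𝟎 u , trans (#V-𝟎 u) (+-comm (#H u) (#V u))
#⊥∥-∷ true  false u = trans (#H-𝟏 u) (+-comm (#H u) (#V u)) , #V-𝟏 u

mutual
  num : Word → ℕ
  num []          = 1
  num (true ∷ W)  = num W + den W
  num (false ∷ W) = num W

  den : Word → ℕ
  den []          = 1
  den (true ∷ W)  = den W
  den (false ∷ W) = num W + den W

#⊥∥-θ : ∀ W → #⊥ (isEven (length W)) (θ W) ≡ num W × #∥ (isEven (length W)) (θ W) ≡ den W
#⊥∥-θ [] = refl , refl
#⊥∥-θ (true ∷ W) =
  let (⊥-step , ∥-step) = #⊥∥-∷ true (isEven (length W)) (θ W)
      (⊥-ih , ∥-ih) = #⊥∥-θ W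
  in trans ⊥-step (cong₂ _+_ ⊥-ih ∥-ih) , trans ∥-step ∥-ih
#⊥∥-θ (false ∷ W) =
  let (⊥-step , ∥-step) = #⊥∥-∷ false (isEven (length W)) (θ W)
      (⊥-ih , ∥-ih) = #⊥∥-θ W
  in trans ⊥-step ⊥-ih , trans ∥-step (cong₂ _+_ ⊥-ih ∥-ih)

θ-length : ∀ W → length (θ W) ≡ length W
θ-length []      = refl
θ-length (_ ∷ W) = cong suc (θ-length W)

⊥-orientation : ∀ b h → (b ∧ h) ∨ (not b ∧ not h) ≡ (if b then h else not h)
⊥-orientation true  h = ∨-identityʳ h
⊥-orientation false h = refl

∥-orientation : ∀ b h → not ((b ∧ h) ∨ (not b ∧ not h)) ≡ (if b then not h else h)
∥-orientation true  h = cong not (∨-identityʳ h)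
∥-orientation false h = not-involutive h

numPerp≡num : ∀ as → numPerp as ≡ num (Wcf as)
numPerp≡num as = begin
  countᵇ (isPerp s) (filterᵇ (isPerfectMatching s) (subsets (edges s)))
    ≡⟨ countᵇ-filterᵇ (isPerfectMatching s) (isPerp s) (subsets (edges s)) ⟩
  countᵇ (λ M → isPerp s M ∧ isPerfectMatching s M) (subsets (edges s))
    ≡⟨ countᵇ-cong (λ M → cong (_∧ isPerfectMatching s M)
                               (⊥-orientation (isEven (length s)) (firstEdgeHorizontal M)))
                   (subsets (edges s)) ⟩
  #⊥ (isEven (length s)) s
    ≡⟨ cong (λ n → #⊥ (isEven n) s) (θ-length (Wcf as)) ⟩
  #⊥ (isEven (length (Wcf as))) s
    ≡⟨ proj₁ (#⊥∥-θ (Wcf as)) ⟩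
  num (Wcf as) ∎
  where
  open ≡-Reasoning
  s : Word
  s = snakeWord as

numPar≡den : ∀ as → numPar as ≡ den (Wcf as)
numPar≡den as = begin
  countᵇ (not ∘ isPerp s) (filterᵇ (isPerfectMatching s) (subsets (edges s)))
    ≡⟨ countᵇ-filterᵇ (isPerfectMatching s) (not ∘ isPerp s) (subsets (edges s)) ⟩
  countᵇ (λ M → not (isPerp s M) ∧ isPerfectMatching s M) (subsets (edges s))
    ≡⟨ countᵇ-cong (λ M → cong (_∧ isPerfectMatching s M)
                               (∥-orientation (isEven (length s)) (firstEdgeHorizontal M)))
                   (subsets (edges s)) ⟩
  #∥ (isEven (length s)) s
    ≡⟨ cong (λ n → #∥ (isEven n) s) (θ-length (Wcf as)) ⟩
  #∥ (isEven (length (Wcf as))) s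
    ≡⟨ proj₂ (#⊥∥-θ (Wcf as)) ⟩
  den (Wcf as) ∎
  where
  open ≡-Reasoning
  s : Word
  s = snakeWord as

num-𝟏ⁿ : ∀ n W → num (replicate n true ++ W) ≡ n * den W + num W
den-𝟏ⁿ : ∀ n W → den (replicate n true ++ W) ≡ den W
num-𝟏ⁿ zero    W = refl
num-𝟏ⁿ (suc n) W = begin
  num (replicate n true ++ W) + den (replicate n true ++ W) ≡⟨ cong₂ _+_ (num-𝟏ⁿ n W) (den-𝟏ⁿ n W) ⟩
  (n * den W + num W) + den W                               ≡⟨ +-comm _ (den W) ⟩
  den W + (n * den W + num W)                               ≡⟨ +-assoc (den W) _ _ ⟨
  suc n * den W + num W                                     ∎
  where open ≡-Reasoning
den-𝟏ⁿ zero    W = refl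
den-𝟏ⁿ (suc n) W = den-𝟏ⁿ n W

num-𝟎ⁿ : ∀ n W → num (replicate n false ++ W) ≡ num W
num-𝟎ⁿ zero    W = refl
num-𝟎ⁿ (suc n) W = num-𝟎ⁿ n W

den-𝟎ⁿ : ∀ n W → den (replicate n false ++ W) ≡ n * num W + den W
den-𝟎ⁿ zero    W = refl
den-𝟎ⁿ (suc n) W = trans (cong₂ _+_ (num-𝟎ⁿ n W) (den-𝟎ⁿ n W)) (sym (+-assoc (num W) _ _))

num-den-𝟎ⁿ : ∀ n → num (replicate n false) ≡ 1 × den (replicate n false) ≡ suc n
num-den-𝟎ⁿ zero    = refl , refl
num-den-𝟎ⁿ (suc n) = let (num≡1 , den≡) = num-den-𝟎ⁿ n in num≡1 , cong₂ _+_ num≡1 den≡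

-- Only the last partial quotient must be positive, since Wcf subtracts 1 from it.
data PairedCF : List ℕ → Set where
  last : ∀ a k → PairedCF (a ∷ suc k ∷ [])
  pair : ∀ a b {as} → PairedCF as → PairedCF (a ∷ b ∷ as)

evenCF⇒pairedCF : ∀ {as} → EvenCF as → PairedCF as
evenCF⇒pairedCF record { ℓ = suc ℓ ; len = len ; tailPos = pos } = paired ℓ _ (trans len (*-suc 2 ℓ)) pos
  where
  paired : ∀ ℓ as → length as ≡ suc (suc (2 * ℓ)) → AllPos (drop 1 as) → PairedCF as
  paired zero    (a ∷ suc k ∷ [])    _   _             = last a k
  paired zero    (a ∷ zero ∷ [])     _   (() ∷ _)
  paired zero    (a ∷ b ∷ _ ∷ _)     ()
  paired (suc ℓ) (a ∷ b ∷ [])        ()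
  paired (suc ℓ) (a ∷ b ∷ c ∷ as)    len (_ ∷ _ ∷ pos) =
    pair a b (paired ℓ (c ∷ as) (trans (suc-injective (suc-injective len)) (*-suc 2 ℓ)) pos)

Wcf-pair : ∀ a b {as} → PairedCF as → Wcf (a ∷ b ∷ as) ≡ replicate a true ++ replicate b false ++ Wcf as
Wcf-pair a b (last _ _)   = refl
Wcf-pair a b (pair _ _ _) = refl

cfVal-pair : ∀ a b {as} → PairedCF as →
  let (p , q) = cfVal as in cfVal (a ∷ b ∷ as) ≡ (a * (b * p + q) + p , b * p + q)
cfVal-pair a b (last _ _)   = refl
cfVal-pair a b (pair _ _ _) = refl

Wcf-continuants : ∀ {as} → PairedCF as →
  num (Wcf as) ≡ proj₁ (cfVal as) × den (Wcf as) ≡ proj₂ (cfVal as)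
Wcf-continuants (last a k) =
  let (num≡1 , den≡) = num-den-𝟎ⁿ k
  in trans (num-𝟏ⁿ a _) (cong₂ (λ d n → a * d + n) den≡ num≡1) , trans (den-𝟏ⁿ a _) den≡
Wcf-continuants (pair a b {as} paired) = numerator , denominator
  where
  open ≡-Reasoning
  W : Word
  W = Wcf as
  p q : ℕ
  p = proj₁ (cfVal as)
  q = proj₂ (cfVal as)
  num≡p : num W ≡ p
  num≡p = proj₁ (Wcf-continuants paired)
  den≡q : den W ≡ q
  den≡q = proj₂ (Wcf-continuants paired)

  numerator : num (Wcf (a ∷ b ∷ as)) ≡ proj₁ (cfVal (a ∷ b ∷ as))
  numerator = begin
    num (Wcf (a ∷ b ∷ as))
      ≡⟨ cong num (Wcf-pair a b paired) ⟩
    num (replicate a true ++ replicate b false ++ W)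
      ≡⟨ num-𝟏ⁿ a _ ⟩
    a * den (replicate b false ++ W) + num (replicate b false ++ W)
      ≡⟨ cong₂ (λ d n → a * d + n) (den-𝟎ⁿ b W) (num-𝟎ⁿ b W) ⟩
    a * (b * num W + den W) + num W
      ≡⟨ cong₂ (λ n d → a * (b * n + d) + n) num≡p den≡q ⟩
    a * (b * p + q) + p
      ≡⟨ cong proj₁ (cfVal-pair a b paired) ⟨
    proj₁ (cfVal (a ∷ b ∷ as)) ∎

  denominator : den (Wcf (a ∷ b ∷ as)) ≡ proj₂ (cfVal (a ∷ b ∷ as))
  denominator = begin
    den (Wcf (a ∷ b ∷ as))                           ≡⟨ cong den (Wcf-pair a b paired) ⟩
    den (replicate a true ++ replicate b false ++ W) ≡⟨ den-𝟏ⁿ a _ ⟩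
    den (replicate b false ++ W)                     ≡⟨ den-𝟎ⁿ b W ⟩
    b * num W + den W                                ≡⟨ cong₂ (λ n d → b * n + d) num≡p den≡q ⟩
    b * p + q                                        ≡⟨ cong proj₂ (cfVal-pair a b paired) ⟨
    proj₂ (cfVal (a ∷ b ∷ as))                       ∎

num-den-coprime : ∀ W → Coprime (num W) (den W)
num-den-coprime []          (d∣1 , _) = ∣1⇒≡1 d∣1
num-den-coprime (true ∷ W)  =
  subst (λ n → Coprime n (den W)) (+-comm (den W) (num W)) (coprime-+ (num-den-coprime W))
num-den-coprime (false ∷ W) = Coprime.sym (coprime-+ (Coprime.sym (num-den-coprime W)))

den-positive : ∀ W → 0 < den W
den-positive []          = s≤s z≤n
den-positive (true ∷ W)  = den-positive W
den-positive (false ∷ W) = <-≤-trans (den-positive W) (m≤n+m (den W) (num W))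

fraction-unique : ∀ (x : ℚ) {p q} → Coprime p q → 0 < q →
  ↥ x Data.Integer.* + q ≡ + p Data.Integer.* + ↧ₙ x → ↥ x ≡ + p × ↧ₙ x ≡ q
fraction-unique x {p} {suc q-1} coprime _ eq = cong ↥_ x≡p/q , cong ↧ₙ_ x≡p/q
  where
  x≡p/q : x ≡ mkℚ (+ p) q-1 coprime
  x≡p/q = ≃⇒≡ (*≡* eq)

theorem7p10 : (x : ℚ) → x > 0ℚ → (as : List ℕ) → EvenCF as →
              (↥ x Data.Integer.* + proj₂ (cfVal as) ≡ + proj₁ (cfVal as) Data.Integer.* + ↧ₙ x) →
              (↥ x ≡ + numPerp as) × (↧ₙ x ≡ numPar as) × Coprime (numPerp as) (numPar as)
theorem7p10 x _ as evenCF eq =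
  let (↥x≡p , ↧ₙx≡q) = fraction-unique x p⊥q (subst (0 <_) den≡q (den-positive W)) eq
  in trans ↥x≡p (cong +_ (sym perp≡p)) , trans ↧ₙx≡q (sym par≡q) ,
     subst₂ Coprime (sym perp≡p) (sym par≡q) p⊥q
  where
  W : Word
  W = Wcf as
  num≡p : num W ≡ proj₁ (cfVal as)
  num≡p = proj₁ (Wcf-continuants (evenCF⇒pairedCF evenCF))
  den≡q : den W ≡ proj₂ (cfVal as)
  den≡q = proj₂ (Wcf-continuants (evenCF⇒pairedCF evenCF))
  perp≡p : numPerp as ≡ proj₁ (cfVal as)
  perp≡p = trans (numPerp≡num as) num≡p
  par≡q : numPar as ≡ proj₂ (cfVal as)
  par≡q = trans (numPar≡den as) den≡q
  p⊥q : Coprime (proj₁ (cfVal as)) (proj₂ (cfVal as))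
  p⊥q = subst₂ Coprime num≡p den≡q (num-den-coprime W)
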